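{- Let $n,k$ be positive integers with $4\le 2k\le n$, and let $\mathcal{G}\subseteq 2^{[n]}$ be a collection of subsets of $[n]$, each containing at most $k$ elements, such that the family $\mathcal{F}(\mathcal{G})=\{S\in\binom{[n]}{k}: S\preceq G\text{ for some }G\in\mathcal{G}\}$ is a left-compressed intersecting family. For each $G=\{g_1<\dots<g_s\}\in\mathcal{G}$ let $r$ be the largest index such that $g_r<k+r$ (such an index exists under these hypotheses), and set $\pi(G)=\{g_1,\dots,g_r\}$; let $\pi(\mathcal{G})=\{\pi(G):G\in\mathcal{G}\}$. Then $\mathcal{F}(\pi(\mathcal{G}))=\{S\in\binom{[n]}{k}: S\preceq G'\text{ for some }G'\in\pi(\mathcal{G})\}$ is also a left-compressed intersecting family, and $\mathcal{F}(\mathcal{G})\subseteq\mathcal{F}(\pi(\mathcal{G}))$.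
   Context: $[n]=\{1,\dots,n\}$; $\binom{[n]}{k}$ is the collection of $k$-element subsets of $[n]$; sets are listed in increasing order. For $A=\{a_1<\dots<a_r\}$ and $B=\{b_1<\dots<b_s\}$, $A\preceq B$ means $r\ge s$ and $a_i\le b_i$ for $1\le i\le s$. For $k$-sets $A,B$, $A\le B$ means $a_i\le b_i$ for all $i$. A family $\mathcal{A}\subseteq\binom{[n]}{k}$ is left-compressed if $A\in\mathcal{A}$ and $B\le A$ imply $B\in\mathcal{A}$; it is intersecting if any two members intersect. A left-compressed intersecting family is abbreviated LCIF. -}

module Defs where

open import Data.Nat using (ℕ; zero; suc; _+_; _≤_; _<_; _<?_)
open import Data.List using (List; []; _∷_; length; take; map)
open import Data.List.Relation.Unary.All using (All)
open import Data.List.Relation.Unary.Linked using (Linked)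
open import Data.List.Relation.Binary.Pointwise using (Pointwise)
open import Data.List.Membership.Propositional using (_∈_)
open import Data.Product using (_×_; ∃-syntax)
open import Relation.Binary.PropositionalEquality using (_≡_)
open import Relation.Nullary using (yes; no)

-- A finite subset of ℕ is represented by the list of its elements in
-- strictly increasing order.

IsKSet : ℕ → ℕ → List ℕ → Set
IsKSet n k S = Linked _<_ S × All (λ x → 1 ≤ x × x ≤ n) S × length S ≡ k

data _⪯_ : List ℕ → List ℕ → Set where
  ⪯-done : ∀ {A} → A ⪯ []
  ⪯-step : ∀ {a b A B} → a ≤ b → A ⪯ B → (a ∷ A) ⪯ (b ∷ B)

_≤ˢ_ : List ℕ → List ℕ → Set
A ≤ˢ B = Pointwise _≤_ A B

LeftCompressed : ℕ → ℕ → (List ℕ → Set) → Set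
LeftCompressed n k 𝒜 = ∀ A B → 𝒜 A → IsKSet n k B → B ≤ˢ A → 𝒜 B

Intersecting : (List ℕ → Set) → Set
Intersecting 𝒜 = ∀ A B → 𝒜 A → 𝒜 B → ∃[ x ] (x ∈ A × x ∈ B)

LCIF : ℕ → ℕ → (List ℕ → Set) → Set
LCIF n k 𝒜 = LeftCompressed n k 𝒜 × Intersecting 𝒜

𝓕 : ℕ → ℕ → List (List ℕ) → List ℕ → Set
𝓕 n k 𝒢 S = IsKSet n k S × ∃[ G ] (G ∈ 𝒢 × S ⪯ G)

-- piIdx k i (g_i ∷ g_{i+1} ∷ …) = largest index r ≥ i with g_r < k + r,
-- or 0 if there is none.
piIdx : ℕ → ℕ → List ℕ → ℕ
piIdx k i [] = 0
piIdx k i (g ∷ gs) with piIdx k (suc i) gs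
... | suc r = suc r
... | zero with g <? k + i
...   | yes _ = i
...   | no _ = 0

π : ℕ → List ℕ → List ℕ
π k G = take (piIdx k 1 G) G

πFam : ℕ → List (List ℕ) → List (List ℕ)
πFam k 𝒢 = map (π k) 𝒢

-- If A ⪯ π G and B ⪯ π H were disjoint, replace every element of A ∪ B by
-- its rank in A ∪ B. This gives disjoint k-sets A′ ≤ A and B′ ≤ B inside
-- [2k] whose i-th elements are at most k + i. Past index r = |π G| the
-- elements of G satisfy g_i ≥ k + i, so A′ ⪯ G, and likewise B′ ⪯ H,
-- contradicting that 𝓕(𝒢) is intersecting. Left-compression of 𝓕(π 𝒢) and
-- the inclusion 𝓕(𝒢) ⊆ 𝓕(π 𝒢) are immediate, π G being a prefix of G.
module Submission where

open import Defs
open import Data.Bool using (true; false; if_then_else_)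
open import Data.Empty using (⊥-elim)
open import Data.List using (List; []; _∷_; _++_; length; take)
open import Data.List.Membership.Propositional using (_∈_; _∉_; find; lose)
open import Data.List.Membership.Propositional.Properties using (∈-map⁺; ∈-map⁻)
open import Data.List.Relation.Binary.Disjoint.Propositional using (Disjoint; contractₗ; contractᵣ)
import Data.List.Relation.Binary.Disjoint.Propositional.Properties as Disjoint
open import Data.List.Relation.Binary.Pointwise using ([]; _∷_)
open import Data.List.Relation.Unary.All using (All; []; _∷_)
import Data.List.Relation.Unary.All as All
open import Data.List.Relation.Unary.Any using (here; there; any?)
open import Data.List.Relation.Unary.Linked using (Linked; []; [-]; _∷_)
open import Data.List.Relation.Unary.Linked.Properties using (Linked⇒All)
open import Data.Nat using (ℕ; zero; suc; _+_; _*_; _≤_; _<_; _<ᵇ_; _<?_; s≤s)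
open import Data.Nat.Properties
open import Data.List.Membership.DecPropositional _≟_ using (_∈?_)
open import Data.Product using (_×_; ∃-syntax; ∃₂; _,_; proj₁; proj₂)
open import Data.Sum using (_⊎_; inj₁; inj₂)
open import Function using (_∘_)
open import Relation.Binary.PropositionalEquality using (_≡_; _≢_; refl; sym; trans; cong; subst)
open import Relation.Nullary using (yes; no; ¬_)
open import Relation.Nullary.Reflects using (ofʸ; ofⁿ)

data AscendingFrom : ℕ → List ℕ → Set where
  []  : ∀ {c} → AscendingFrom c []
  _∷_ : ∀ {c x xs} → c ≤ x → AscendingFrom (suc x) xs → AscendingFrom c (x ∷ xs)

data _≤↗_ : List ℕ → ℕ → Set where
  []  : ∀ {b} → [] ≤↗ b
  _∷_ : ∀ {b x xs} → x ≤ b → xs ≤↗ suc b → (x ∷ xs) ≤↗ b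

data _↗≤_ : ℕ → List ℕ → Set where
  []  : ∀ {b} → b ↗≤ []
  _∷_ : ∀ {b x xs} → b ≤ x → suc b ↗≤ xs → b ↗≤ (x ∷ xs)

ascending-weaken : ∀ {c d xs} → d ≤ c → AscendingFrom c xs → AscendingFrom d xs
ascending-weaken d≤c [] = []
ascending-weaken d≤c (c≤x ∷ xs↑) = ≤-trans d≤c c≤x ∷ xs↑

ascending⇒All≥ : ∀ {c xs} → AscendingFrom c xs → All (c ≤_) xs
ascending⇒All≥ [] = []
ascending⇒All≥ (c≤x ∷ xs↑) = c≤x ∷ All.map (≤-trans c≤x ∘ <⇒≤) (ascending⇒All≥ xs↑)

ascending⇒linked : ∀ {c xs} → AscendingFrom c xs → Linked _<_ xs
ascending⇒linked [] = []
ascending⇒linked (_ ∷ []) = [-]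
ascending⇒linked (_ ∷ xs↑@(x<y ∷ _)) = x<y ∷ ascending⇒linked xs↑

linked⇒ascending : ∀ {c xs} → Linked _<_ xs → All (c ≤_) xs → AscendingFrom c xs
linked⇒ascending [] [] = []
linked⇒ascending [-] (c≤x ∷ []) = c≤x ∷ []
linked⇒ascending (x<y ∷ ys<) (c≤x ∷ _) = c≤x ∷ linked⇒ascending ys< (Linked⇒All <-trans x<y ys<)

≤↗⇒All≤ : ∀ {b xs} → xs ≤↗ suc b → All (_≤ length xs + b) xs
≤↗⇒All≤ [] = []
≤↗⇒All≤ {b} {x ∷ xs} (x≤ ∷ xs≤↗) =
  ≤-trans x≤ (s≤s (m≤n+m b (length xs))) ∷
  All.map (λ y≤ → ≤-trans y≤ (≤-reflexive (+-suc (length xs) b))) (≤↗⇒All≤ xs≤↗)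

isKSet-of-≤↗ : ∀ {n k xs} → 2 * k ≤ n → AscendingFrom 1 xs → xs ≤↗ suc k → length xs ≡ k →
               IsKSet n k xs
isKSet-of-≤↗ {n} {k} {xs} 2k≤n xs↑ xs≤↗ |xs|≡k =
  ascending⇒linked xs↑ , All.zip (ascending⇒All≥ xs↑ , All.map ≤n (≤↗⇒All≤ xs≤↗)) , |xs|≡k
  where
  ≤n : ∀ {x} → x ≤ length xs + k → x ≤ n
  ≤n x≤ = ≤-trans x≤ (subst (λ m → m + k ≤ n) (sym |xs|≡k)
                        (subst (_≤ n) (cong (k +_) (+-identityʳ k)) 2k≤n))

-- ranks c A B lists the positions, counted from c, of the elements of A in
-- the increasing enumeration of A ∪ B. It branches with if, and its lemmas
-- make both recursive calls in the with-clause, so that the termination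
-- checker sees the lexicographic descent on (A , B).
ranks : ℕ → List ℕ → List ℕ → List ℕ
ranks c [] B = []
ranks c (a ∷ A) [] = c ∷ ranks (suc c) A []
ranks c (a ∷ A) (b ∷ B) =
  if a <ᵇ b then c ∷ ranks (suc c) A (b ∷ B) else ranks (suc c) (a ∷ A) B

ranks-length : ∀ c A B → length (ranks c A B) ≡ length A
ranks-length c [] B = refl
ranks-length c (a ∷ A) [] = cong suc (ranks-length (suc c) A [])
ranks-length c (a ∷ A) (b ∷ B)
  with a <ᵇ b | ranks-length (suc c) A (b ∷ B) | ranks-length (suc c) (a ∷ A) B
... | true  | ih | _ = cong suc ih
... | false | _ | ih = ih

ranks-ascending : ∀ c A B → AscendingFrom c (ranks c A B)
ranks-ascending c [] B = []
ranks-ascending c (a ∷ A) [] = ≤-refl ∷ ranks-ascending (suc c) A []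
ranks-ascending c (a ∷ A) (b ∷ B)
  with a <ᵇ b | ranks-ascending (suc c) A (b ∷ B) | ranks-ascending (suc c) (a ∷ A) B
... | true  | A'↑ | _ = ≤-refl ∷ A'↑
... | false | _ | A'↑ = ascending-weaken (n≤1+n c) A'↑

ranks-≤↗ : ∀ c A B → ranks c A B ≤↗ (c + length B)
ranks-≤↗ c [] B = []
ranks-≤↗ c (a ∷ A) [] = m≤m+n c 0 ∷ ranks-≤↗ (suc c) A []
ranks-≤↗ c (a ∷ A) (b ∷ B)
  with a <ᵇ b | ranks-≤↗ (suc c) A (b ∷ B) | ranks-≤↗ (suc c) (a ∷ A) B
... | true  | A'≤↗ | _ = m≤m+n c _ ∷ A'≤↗
... | false | _ | A'≤↗ = subst (ranks (suc c) (a ∷ A) B ≤↗_) (sym (+-suc c (length B))) A'≤↗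

disjoint-heads : ∀ {a b : ℕ} {A B} → Disjoint (a ∷ A) (b ∷ B) → a ≢ b
disjoint-heads A#B a≡b = A#B (here refl , here a≡b)

ranks-≤ˢ : ∀ {c} A B → AscendingFrom c A → AscendingFrom c B → Disjoint A B → ranks c A B ≤ˢ A
ranks-≤ˢ [] B _ _ _ = []
ranks-≤ˢ (a ∷ A) [] (c≤a ∷ A↑) _ _ =
  c≤a ∷ ranks-≤ˢ A [] (ascending-weaken (s≤s c≤a) A↑) [] (λ ())
ranks-≤ˢ {c} (a ∷ A) (b ∷ B) (c≤a ∷ A↑) (c≤b ∷ B↑) A#B
  with a <ᵇ b | <ᵇ-reflects-< a b | ranks-≤ˢ {suc c} A (b ∷ B) | ranks-≤ˢ {suc c} (a ∷ A) B
... | true  | ofʸ a<b | ih | _ =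
  c≤a ∷ ih (ascending-weaken (s≤s c≤a) A↑) (≤-trans (s≤s c≤a) a<b ∷ B↑) (contractₗ A#B)
... | false | ofⁿ a≮b | _ | ih =
  ih (≤-trans (s≤s c≤b) b<a ∷ A↑) (ascending-weaken (s≤s c≤b) B↑) (contractᵣ A#B)
  where
  b<a : b < a
  b<a = ≤∧≢⇒< (≮⇒≥ a≮b) (disjoint-heads A#B ∘ sym)

disjoint-∷ˡ : ∀ {c : ℕ} {X Y} → c ∉ Y → Disjoint X Y → Disjoint (c ∷ X) Y
disjoint-∷ˡ c∉Y X#Y (here refl , c∈Y) = c∉Y c∈Y
disjoint-∷ˡ c∉Y X#Y (there v∈X , v∈Y) = X#Y (v∈X , v∈Y)

∉-ascending : ∀ {c xs} → AscendingFrom (suc c) xs → c ∉ xs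
∉-ascending xs↑ c∈xs = 1+n≰n (All.lookup (ascending⇒All≥ xs↑) c∈xs)

ranks-disjoint : ∀ c A B → Disjoint A B → Disjoint (ranks c A B) (ranks c B A)
ranks-disjoint c [] B _ (() , _)
ranks-disjoint c (a ∷ A) [] _ (_ , ())
ranks-disjoint c (a ∷ A) (b ∷ B) A#B
  with a <ᵇ b | <ᵇ-reflects-< a b | b <ᵇ a | <ᵇ-reflects-< b a
     | ranks-disjoint (suc c) A (b ∷ B) | ranks-disjoint (suc c) (a ∷ A) B
... | true  | ofʸ a<b | true  | ofʸ b<a | _ | _ = ⊥-elim (<-asym a<b b<a)
... | true  | _       | false | _       | ih | _ =
  disjoint-∷ˡ (∉-ascending (ranks-ascending (suc c) (b ∷ B) A)) (ih (contractₗ A#B))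
... | false | _       | true  | _       | _ | ih =
  Disjoint.sym (disjoint-∷ˡ (∉-ascending (ranks-ascending (suc c) (a ∷ A) B))
                            (Disjoint.sym (ih (contractᵣ A#B))))
... | false | ofⁿ a≮b | false | ofⁿ b≮a | _ | _ =
  ⊥-elim (disjoint-heads A#B (≤-antisym (≮⇒≥ b≮a) (≮⇒≥ a≮b)))

≤ˢ-⪯-trans : ∀ {A B G} → B ≤ˢ A → A ⪯ G → B ⪯ G
≤ˢ-⪯-trans _ ⪯-done = ⪯-done
≤ˢ-⪯-trans (b≤a ∷ B≤A) (⪯-step a≤g A⪯G) = ⪯-step (≤-trans b≤a a≤g) (≤ˢ-⪯-trans B≤A A⪯G)

⪯-take : ∀ {S G} m → S ⪯ G → S ⪯ take m G
⪯-take zero _ = ⪯-done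
⪯-take (suc m) ⪯-done = ⪯-done
⪯-take (suc m) (⪯-step s≤g S⪯G) = ⪯-step s≤g (⪯-take m S⪯G)

≤↗-↗≤-⪯ : ∀ {b X Y} → X ≤↗ b → b ↗≤ Y → length Y ≤ length X → X ⪯ Y
≤↗-↗≤-⪯ _ [] _ = ⪯-done
≤↗-↗≤-⪯ (x≤b ∷ X≤↗) (b≤y ∷ ↗≤Y) (s≤s |Y|≤|X|) = ⪯-step (≤-trans x≤b b≤y) (≤↗-↗≤-⪯ X≤↗ ↗≤Y |Y|≤|X|)

⪯-++ : ∀ {b X P R} → X ⪯ P → X ≤↗ b → (length P + b) ↗≤ R → length (P ++ R) ≤ length X →
       X ⪯ (P ++ R)
⪯-++ {P = []} _ X≤↗ ↗≤R |R|≤|X| = ≤↗-↗≤-⪯ X≤↗ ↗≤R |R|≤|X|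
⪯-++ {b} {P = p ∷ P} {R} (⪯-step x≤p X⪯P) (_ ∷ X≤↗) ↗≤R (s≤s |P++R|≤|X|) =
  ⪯-step x≤p (⪯-++ X⪯P X≤↗ (subst (_↗≤ R) (sym (+-suc (length P) b)) ↗≤R) |P++R|≤|X|)

take-length-++ : ∀ (P R : List ℕ) → take (length P) (P ++ R) ≡ P
take-length-++ [] R = refl
take-length-++ (p ∷ P) R = cong (p ∷_) (take-length-++ P R)

piIdx-spec : ∀ k i G →
  (piIdx k i G ≡ 0 × (i + k) ↗≤ G) ⊎
  ∃[ p ] ∃₂ λ P R → G ≡ p ∷ P ++ R × piIdx k i G ≡ i + length P ×
                    (length (p ∷ P) + (i + k)) ↗≤ R
piIdx-spec k i [] = inj₁ (refl , [])
piIdx-spec k i (g ∷ gs) with piIdx k (suc i) gs | piIdx-spec k (suc i) gs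
... | suc r | inj₁ (() , _)
... | suc r | inj₂ (p , P , R , refl , r≡ , ↗≤R) =
  inj₂ (g , p ∷ P , R , refl , trans r≡ (sym (+-suc i (length P))) ,
        subst (λ j → suc j ↗≤ R) (+-suc (length P) (i + k)) ↗≤R)
... | zero | inj₂ (_ , _ , _ , _ , () , _)
... | zero | inj₁ (_ , ↗≤gs) with g <? k + i
...   | yes _ = inj₂ (g , [] , gs , refl , sym (+-identityʳ i) , ↗≤gs)
...   | no g≮ = inj₁ (refl , subst (_≤ g) (+-comm k i) (≮⇒≥ g≮) ∷ ↗≤gs)

π-prefix : ∀ k G → ∃₂ λ P R → G ≡ P ++ R × π k G ≡ P × (length P + suc k) ↗≤ R
π-prefix k G with piIdx-spec k 1 G
... | inj₁ (r≡0 , ↗≤G) = [] , G , refl , cong (λ r → take r G) r≡0 , ↗≤G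
... | inj₂ (p , P , R , refl , r≡ , ↗≤R) =
  p ∷ P , R , refl , trans (cong (λ r → take r (p ∷ P ++ R)) r≡) (take-length-++ (p ∷ P) R) , ↗≤R

⪯-π⇒⪯ : ∀ {k X} G → X ⪯ π k G → X ≤↗ suc k → length G ≤ length X → X ⪯ G
⪯-π⇒⪯ {k} {X} G X⪯πG X≤↗ |G|≤|X| with π-prefix k G
... | P , R , refl , πG≡P , ↗≤R = ⪯-++ (subst (X ⪯_) πG≡P X⪯πG) X≤↗ ↗≤R |G|≤|X|

never-disjoint⇒intersecting : ∀ {𝒜 : List ℕ → Set} →
  (∀ A B → 𝒜 A → 𝒜 B → ¬ Disjoint A B) → Intersecting 𝒜
never-disjoint⇒intersecting never A B A∈𝒜 B∈𝒜 with any? (_∈? B) A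
... | yes common = find common
... | no ¬common = ⊥-elim (never A B A∈𝒜 B∈𝒜 λ (x∈A , x∈B) → ¬common (lose x∈A x∈B))

ranks-∈𝓕 : ∀ {n k 𝒢 A B G} → 2 * k ≤ n → IsKSet n k A → IsKSet n k B → Disjoint A B →
           G ∈ 𝒢 → length G ≤ k → A ⪯ π k G → 𝓕 n k 𝒢 (ranks 1 A B)
ranks-∈𝓕 {k = k} {A = A} {B} {G} 2k≤n (A< , A∈[n] , |A|≡k) (B< , B∈[n] , |B|≡k) A#B G∈𝒢 |G|≤k A⪯πG =
  isKSet-of-≤↗ 2k≤n (ranks-ascending 1 A B) A'≤↗ |A'|≡k , G , G∈𝒢 ,
  ⪯-π⇒⪯ G (≤ˢ-⪯-trans A'≤A A⪯πG) A'≤↗ (subst (length G ≤_) (sym |A'|≡k) |G|≤k)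
  where
  A'≤A : ranks 1 A B ≤ˢ A
  A'≤A = ranks-≤ˢ A B (linked⇒ascending A< (All.map proj₁ A∈[n]))
                      (linked⇒ascending B< (All.map proj₁ B∈[n])) A#B
  A'≤↗ : ranks 1 A B ≤↗ suc k
  A'≤↗ = subst (λ m → ranks 1 A B ≤↗ suc m) |B|≡k (ranks-≤↗ 1 A B)
  |A'|≡k : length (ranks 1 A B) ≡ k
  |A'|≡k = trans (ranks-length 1 A B) |A|≡k

𝓕-π-intersecting : ∀ {n k 𝒢} → 2 * k ≤ n → All (λ G → length G ≤ k) 𝒢 →
                   Intersecting (𝓕 n k 𝒢) → Intersecting (𝓕 n k (πFam k 𝒢))
𝓕-π-intersecting {n} {k} {𝒢} 2k≤n short intersecting = never-disjoint⇒intersecting never-disjoint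
  where
  never-disjoint : ∀ A B → 𝓕 n k (πFam k 𝒢) A → 𝓕 n k (πFam k 𝒢) B → ¬ Disjoint A B
  never-disjoint A B (A∈ , _ , πG∈ , A⪯πG) (B∈ , _ , πH∈ , B⪯πH) A#B
    with ∈-map⁻ (π k) πG∈ | ∈-map⁻ (π k) πH∈
  ... | G , G∈𝒢 , refl | H , H∈𝒢 , refl =
    ranks-disjoint 1 A B A#B (proj₂ (intersecting _ _
      (ranks-∈𝓕 2k≤n A∈ B∈ A#B G∈𝒢 (All.lookup short G∈𝒢) A⪯πG)
      (ranks-∈𝓕 2k≤n B∈ A∈ (Disjoint.sym A#B) H∈𝒢 (All.lookup short H∈𝒢) B⪯πH)))

𝓕-leftCompressed : ∀ n k 𝒢 → LeftCompressed n k (𝓕 n k 𝒢)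
𝓕-leftCompressed n k 𝒢 A B (_ , G , G∈𝒢 , A⪯G) B∈ B≤A = B∈ , G , G∈𝒢 , ≤ˢ-⪯-trans B≤A A⪯G

𝓕⊆𝓕-π : ∀ {n k 𝒢} S → 𝓕 n k 𝒢 S → 𝓕 n k (πFam k 𝒢) S
𝓕⊆𝓕-π {k = k} S (S∈ , G , G∈𝒢 , S⪯G) = S∈ , π k G , ∈-map⁺ (π k) G∈𝒢 , ⪯-take (piIdx k 1 G) S⪯G

theorem1p2 : (n k : ℕ) → 4 ≤ 2 * k → 2 * k ≤ n →
    (𝒢 : List (List ℕ)) →
    All (λ G → Linked _<_ G × All (λ x → 1 ≤ x × x ≤ n) G × length G ≤ k) 𝒢 →
    LCIF n k (𝓕 n k 𝒢) →
    LCIF n k (𝓕 n k (πFam k 𝒢)) × (∀ S → 𝓕 n k 𝒢 S → 𝓕 n k (πFam k 𝒢) S)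
theorem1p2 n k _ 2k≤n 𝒢 wf (_ , intersecting) =
  (𝓕-leftCompressed n k (πFam k 𝒢) ,
   𝓕-π-intersecting 2k≤n (All.map (proj₂ ∘ proj₂) wf) intersecting) ,
  𝓕⊆𝓕-π
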